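{- Let $m\geq 2$ be a square-free integer and $k\geq 2$ an integer. Let $(R_n)_{n=0}^\infty$ be a sequence of non-empty subsets of $\{0,1,\dots,m-1\}$ such that for every $n\geq 0$, all distinct $r,r'\in R_{n+1}$ and all $s,s'\in R_n$ we have \[ r-r'\not\equiv (s-s')^k \pmod m. \] Let \[\gamma=(k-1)\sum_{n=0}^{\infty}\frac{\log_m|R_n|}{k^{n+1}}.\] Then for every $\varepsilon>0$ there is a constant $c>0$ depending only on $m$ and $\varepsilon$ such that for every positive integer $N$ there exists a set $A\subseteq[N]$ containing no non-trivial configuration of the form $\{x,x+y,x+y^k\}$ and with $|A|\geq cN^{\gamma-\varepsilon}$.
   Context: $[N]=\{1,2,\dots,N\}$. A configuration $\{x,x+y,x+y^k\}$ in $A$ means integers $x,y$ with $x,x+y,x+y^k\in A$; it is non-trivial if $y\neq 0$.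
   Formalization: The parameter ε ranges over the positive rationals, and the constant c is taken in the positive rationals. -}

module Defs where

open import Data.Nat as ℕ using (ℕ; zero; suc; _≥_; _<_; _≤_)
open import Data.Nat.Divisibility as ND using ()
open import Data.Nat.Primality using (Prime)
open import Data.Integer as ℤ using (ℤ; +_; -[1+_])
open import Data.Integer.Divisibility as ZD using ()
open import Data.Fin using (Fin; toℕ)
open import Data.Fin.Subset using (Subset; _∈_; ∣_∣; Nonempty)
open import Data.Product using (Σ; _×_)
open import Data.Unit using (⊤)
open import Data.Empty using (⊥)
open import Relation.Nullary using (¬_)
open import Relation.Binary.PropositionalEquality using (_≡_; _≢_)

SquareFree : ℕ → Set
SquareFree m = ∀ p → Prime p → ¬ (p ℕ.* p ND.∣ m)

res : {m : ℕ} → Fin m → ℤ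
res r = + toℕ r

Admissible : (m k : ℕ) → (ℕ → Subset m) → Set
Admissible m k R =
  ∀ n (r r' s s' : Fin m) → r ∈ R (suc n) → r' ∈ R (suc n) → r ≢ r' →
  s ∈ R n → s' ∈ R n →
  ¬ ((+ m) ZD.∣ ((res r ℤ.- res r') ℤ.- ((res s ℤ.- res s') ℤ.^ k)))

-- P M = ∏_{n<M} |R_n|^(k^(M-n-1)),  so that
-- log_m (P M) = (k^M / (k-1)) · S_M  where
-- S_M = (k-1) ∑_{n<M} log_m |R_n| / k^(n+1) is the M-th partial sum of γ.
P : (m k : ℕ) → (ℕ → Subset m) → ℕ → ℕ
P m k R zero = 1
P m k R (suc M) = (P m k R M ℕ.^ k) ℕ.* ∣ R M ∣

-- For a rational u = a / b (b ≥ 1):  u < γ.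
-- Since all terms of γ are ≥ 0, u < γ iff u < S_M for some M, i.e.
-- m^(a·k^M) < (P M)^(b(k-1)) (as reals); for a < 0 this always holds.
LtGamma : (m k : ℕ) → (ℕ → Subset m) → ℤ → ℕ → Set
LtGamma m k R (+ a) b =
  Σ ℕ λ M → m ℕ.^ (a ℕ.* k ℕ.^ M) < P m k R M ℕ.^ (b ℕ.* (k ℕ.∸ 1))
LtGamma m k R -[1+ a ] b = ⊤

-- Membership of an integer in A ⊆ [N], where A : Subset N and
-- i : Fin N represents the integer i+1.
_∈[_] : ℤ → {N : ℕ} → Subset N → Set
z ∈[ A ] = Σ (Fin _) λ i → i ∈ A × z ≡ + suc (toℕ i)

ConfigFree : (k : ℕ) → {N : ℕ} → Subset N → Set
ConfigFree k A = ∀ (x y : ℤ) → y ≢ + 0 →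
  x ∈[ A ] → (x ℤ.+ y) ∈[ A ] → (x ℤ.+ y ℤ.^ k) ∈[ A ] → ⊥

-- (p/q) · N^(a/b) ≤ s   (p,q,b ≥ 1), cleared of denominators and roots:
-- (p/q)^b · N^a ≤ s^b.
BoundBelow : (p q : ℕ) → ℤ → (b N s : ℕ) → Set
BoundBelow p q (+ a) b N s = p ℕ.^ b ℕ.* N ℕ.^ a ≤ q ℕ.^ b ℕ.* s ℕ.^ b
BoundBelow p q -[1+ a ] b N s = p ℕ.^ b ≤ q ℕ.^ b ℕ.* s ℕ.^ b ℕ.* N ℕ.^ suc a

module Submission where

-- Let v be the k-adic valuation. Take for A the numbers 1 + X, X < m^L, whose base-m digit 0
-- is 0 and whose digit j ≥ 1 lies in R (v j). If x, x + y, x + y^k ∈ A with y = m^j z and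
-- m ∤ z, then modulo m digit j moves by z ≢ 0 and digit j k by z^k ≢ 0 (m is square-free).
-- As v (j k) = v j + 1 this gives distinct r, r′ ∈ R (v j + 1) and s, s′ ∈ R (v j) with
-- r - r′ ≡ (s - s′)^k, which admissibility forbids. Grouping the positions 1, …, L - 1 by
-- valuation, log_m ∣A∣ = Σ_j log_m ∣R (v j)∣ is at least (L - 1) S_M - O(log L) for every
-- partial sum S_M of γ; the O(log L) is absorbed by ε L, giving ∣A∣ ≥ c N^(γ - ε).

open import Defs
import Algebra.Properties.CommutativeSemigroup as CommutativeSemigroup
open import Data.Empty using (⊥; ⊥-elim)
open import Data.Fin as Fin using (Fin; toℕ)
import Data.Fin.Properties as Fin
open import Data.Fin.Subset using (Subset; ∣_∣; _∈_; inside; outside; _-_; ⁅_⁆; Nonempty)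
open import Data.Fin.Subset.Properties using (∣p∣≤n; x∈⁅y⁆⇒x≡y; ∣⁅x⁆∣≡1; x∈p∧x≢y⇒x∈p-y; x∈p⇒∣p-x∣<∣p∣)
open import Data.Integer as ℤ using (ℤ; +_; -[1+_])
import Data.Integer.Divisibility as ℤᵤ
open import Data.Integer.Divisibility.Signed as ℤ using (_∣_)
import Data.Integer.Properties as ℤ
import Data.Integer.Tactic.RingSolver as ℤ-Solver
open import Data.List using (List; []; _∷_; [_]; _++_; applyUpTo; map; length; cartesianProductWith)
import Data.List.Properties as List
open import Data.List.Membership.Propositional using () renaming (_∈_ to _∈ₗ_)
open import Data.List.Membership.Propositional.Properties using (∈-map⁻; ∈-cartesianProductWith⁻)
open import Data.List.Relation.Unary.All as All using (All; []; _∷_)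
open import Data.List.Relation.Unary.AllPairs using ([]; _∷_)
open import Data.List.Relation.Unary.Any using () renaming (here to hereₗ; there to thereₗ)
open import Data.List.Relation.Unary.Unique.Propositional using (Unique)
import Data.List.Relation.Unary.Unique.Propositional.Properties as Unique
open import Data.Nat as ℕ using (ℕ; zero; suc; _+_; _*_; _^_; _≤_; _<_; _≥_; z≤n; s≤s; NonZero)
open import Data.Nat.Coprimality using (Coprime; coprime-divisor)
open import Data.Nat.Divisibility as ℕ using (divides; divides-refl)
open import Data.Nat.DivMod
  using (_/_; _%_; _mod_; %-distribˡ-+; m%n%n≡m%n; m≡m%n+[m/n]*n; +-distrib-/-∣ʳ; m*n/n≡m; m/n<m; m%n<n;
         m/n*n≤m; m<n*o⇒m/o<n; m<n⇒m%n≡m; [m+kn]%n≡m%n; m<n⇒m/n≡0)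
open import Data.Nat.Induction using (<-wellFounded)
open import Data.Nat.ListAction using (product)
open import Data.Nat.ListAction.Properties using (product-++)
open import Data.Nat.Primality using (Prime; euclidsLemma; prime⇒irreducible; prime⇒nonTrivial)
open import Data.Nat.Primality.Factorisation using (PrimeFactorisation; factorise)
import Data.Nat.Properties as ℕ
import Data.Nat.Tactic.RingSolver as ℕ-Solver
open import Data.Product using (Σ; ∃₂; _×_; _,_; proj₁; proj₂)
open import Data.Sum using (inj₁; inj₂)
open import Data.Vec using ([]; _∷_; here; there; tabulate; lookup)
import Data.Vec.Properties as Vec
open import Function using (_∘_; _on_)
open import Induction.WellFounded using (Acc; acc)
open import Relation.Binary.PropositionalEquality hiding ([_])
import Relation.Binary.Construct.On as On
open import Relation.Nullary using (¬_; yes; no; does)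
open import Relation.Nullary.Decidable using (dec-true)
open import Data.List.Membership.DecPropositional ℕ._≟_ using (_∈?_)

module ℕ* = CommutativeSemigroup ℕ.*-commutativeSemigroup
module ℤ* = CommutativeSemigroup ℤ.*-commutativeSemigroup

^-distrib-* : ∀ a b n → (a * b) ^ n ≡ a ^ n * b ^ n
^-distrib-* a b zero = refl
^-distrib-* a b (suc n) = begin
  a * b * (a * b) ^ n     ≡⟨ cong (a * b *_) (^-distrib-* a b n) ⟩
  a * b * (a ^ n * b ^ n) ≡⟨ ℕ*.interchange a b (a ^ n) (b ^ n) ⟩
  a ^ suc n * b ^ suc n   ∎
  where open ≡-Reasoning

^-cancelˡ-≤ : ∀ n .{{_ : NonZero n}} {a b} → a ^ n ≤ b ^ n → a ≤ b
^-cancelˡ-≤ n {a} {b} aⁿ≤bⁿ with ℕ.≤-<-connex a b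
... | inj₁ a≤b = a≤b
... | inj₂ b<a = ⊥-elim (ℕ.<⇒≱ (ℕ.^-monoˡ-< n b<a) aⁿ≤bⁿ)

^-cancelʳ-< : ∀ a → 1 < a → ∀ {x y} → a ^ x < a ^ y → x < y
^-cancelʳ-< a@(suc _) 1<a {x} {y} aˣ<aʸ with ℕ.<-≤-connex x y
... | inj₁ x<y = x<y
... | inj₂ y≤x = ⊥-elim (ℕ.<⇒≱ aˣ<aʸ (ℕ.^-monoʳ-≤ a y≤x))

[a^m]^n≡a^[n*m] : ∀ a m n → (a ^ m) ^ n ≡ a ^ (n * m)
[a^m]^n≡a^[n*m] a m n = trans (ℕ.^-*-assoc a m n) (cong (a ^_) (ℕ.*-comm m n))

[a^m]^n≡[a^n]^m : ∀ a m n → (a ^ m) ^ n ≡ (a ^ n) ^ m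
[a^m]^n≡[a^n]^m a m n = trans ([a^m]^n≡a^[n*m] a m n) (sym (ℕ.^-*-assoc a n m))

n<2^n : ∀ n → n < 2 ^ n
n<2^n zero = s≤s z≤n
n<2^n (suc n) = begin-strict
  suc n          ≤⟨ n<2^n n ⟩
  2 ^ n          <⟨ ℕ.m<m+n (2 ^ n) (ℕ.m^n>0 2 n) ⟩
  2 ^ n + 2 ^ n  ≡⟨ cong (λ t → 2 ^ n + t) (ℕ.+-identityʳ (2 ^ n)) ⟨
  2 ^ suc n      ∎
  where open ℕ.≤-Reasoning

n<2^[d+n/d] : ∀ d .{{_ : NonZero d}} n → n < 2 ^ (d + n / d)
n<2^[d+n/d] d n = begin-strict
  n                       ≡⟨ m≡m%n+[m/n]*n n d ⟩
  n % d + n / d * d       <⟨ ℕ.+-monoˡ-< (n / d * d) (m%n<n n d) ⟩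
  d + n / d * d           ≡⟨ regroup d (n / d) ⟩
  d * suc (n / d)         ≤⟨ ℕ.*-mono-≤ (ℕ.<⇒≤ (n<2^n d)) (n<2^n (n / d)) ⟩
  2 ^ d * 2 ^ (n / d)     ≡⟨ ℕ.^-distribˡ-+-* 2 d (n / d) ⟨
  2 ^ (d + n / d)         ∎
  where
  open ℕ.≤-Reasoning
  regroup : ∀ d q → d + q * d ≡ d * suc q
  regroup = ℕ-Solver.solve-∀

power-bracket : ∀ m → 1 < m → ∀ N → 1 ≤ N → Σ ℕ λ L → m ^ L ≤ N × N < m ^ suc L
power-bracket m 1<m (suc zero) _ = 0 , ℕ.≤-refl , subst (1 <_) (sym (ℕ.*-identityʳ m)) 1<m
power-bracket m 1<m (suc (suc N)) _ with power-bracket m 1<m (suc N) (s≤s z≤n)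
... | L , mᴸ≤1+N , 1+N<m^[1+L] with ℕ.m≤n⇒m<n∨m≡n 1+N<m^[1+L]
...   | inj₁ 2+N<m^[1+L] = L , ℕ.m≤n⇒m≤1+n mᴸ≤1+N , 2+N<m^[1+L]
...   | inj₂ 2+N≡m^[1+L] = suc L , ℕ.≤-reflexive (sym 2+N≡m^[1+L]) ,
          subst (_< m ^ suc (suc L)) (sym 2+N≡m^[1+L]) (ℕ.^-monoʳ-< m 1<m (ℕ.n<1+n (suc L)))

pos-+-* : ∀ x a w → + (x + a * w) ≡ + x ℤ.+ + a ℤ.* + w
pos-+-* x a w = trans (ℤ.pos-+ x (a * w)) (cong (λ t → + x ℤ.+ t) (ℤ.pos-* a w))

ℤ-^-distrib-* : ∀ a b n → (a ℤ.* b) ℤ.^ n ≡ a ℤ.^ n ℤ.* b ℤ.^ n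
ℤ-^-distrib-* a b zero = refl
ℤ-^-distrib-* a b (suc n) = trans (cong (λ t → a ℤ.* b ℤ.* t) (ℤ-^-distrib-* a b n)) (ℤ*.interchange a b (a ℤ.^ n) (b ℤ.^ n))

pos-^ : ∀ a n → + (a ^ n) ≡ (+ a) ℤ.^ n
pos-^ a zero = refl
pos-^ a (suc n) = trans (ℤ.pos-* a (a ^ n)) (cong (λ t → + a ℤ.* t) (pos-^ a n))

abs-^ : ∀ z n → ℤ.∣ z ℤ.^ n ∣ ≡ ℤ.∣ z ∣ ^ n
abs-^ z zero = refl
abs-^ z (suc n) = trans (ℤ.abs-* z (z ℤ.^ n)) (cong (ℤ.∣ z ∣ *_) (abs-^ z n))

pos-*+* : ∀ a b c d → + (a * b + c * d) ≡ (+ a ℤ.* + b) ℤ.+ (+ c ℤ.* + d)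
pos-*+* a b c d = trans (ℤ.pos-+ (a * b) (c * d)) (cong₂ ℤ._+_ (ℤ.pos-* a b) (ℤ.pos-* c d))

1≤^ : ∀ {a} → 1 ≤ a → ∀ n → 1 ≤ a ^ n
1≤^ {a} a≥1 n = ℕ.m^n>0 a {{ℕ.>-nonZero a≥1}} n

BoundBelow-negative : ∀ {q s N} a b → 1 ≤ q → 1 ≤ s → 1 ≤ N → BoundBelow 1 q -[1+ a ] b N s
BoundBelow-negative {q} {s} {N} a b q≥1 s≥1 N≥1 = subst (_≤ q ^ b * s ^ b * N ^ suc a) (sym (ℕ.^-zeroˡ b))
  (ℕ.*-mono-≤ (ℕ.*-mono-≤ (1≤^ q≥1 b) (1≤^ s≥1 b)) (1≤^ N≥1 (suc a)))

prime∣^⇒∣ : ∀ {p} → Prime p → ∀ n k → p ℕ.∣ n ^ k → p ℕ.∣ n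
prime∣^⇒∣ p-prime n zero p∣1 = ⊥-elim (ℕ.nonTrivial⇒≢1 {{prime⇒nonTrivial p-prime}} (ℕ.∣1⇒≡1 p∣1))
prime∣^⇒∣ p-prime n (suc k) p∣nⁿ with euclidsLemma n (n ^ k) p-prime p∣nⁿ
... | inj₁ p∣n = p∣n
... | inj₂ p∣nᵏ = prime∣^⇒∣ p-prime n k p∣nᵏ

squareFree-∣^⇒∣ : ∀ {m} → SquareFree m → .{{_ : NonZero m}} → ∀ n k → m ℕ.∣ n ^ k → m ℕ.∣ n
squareFree-∣^⇒∣ {m} sqf n k m∣nᵏ =
  subst (ℕ._∣ n) (sym isFactorisation)
    (product∣ factors factorsPrime (subst SquareFree isFactorisation sqf) n
        (subst (ℕ._∣ n ^ k) isFactorisation m∣nᵏ))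
  where
  open PrimeFactorisation (factorise m)
  product∣ : ∀ ps → All Prime ps → SquareFree (product ps) →
             ∀ n → product ps ℕ.∣ n ^ k → product ps ℕ.∣ n
  product∣ [] _ _ n _ = ℕ.1∣ n
  product∣ (p ∷ ps) (p-prime ∷ ps-prime) sqf′ n pps∣nᵏ
    with product∣ ps ps-prime (λ q q-prime q²∣ → sqf′ q q-prime (ℕ.∣-trans q²∣ (ℕ.n∣m*n p))) n
                  (ℕ.∣-trans (ℕ.n∣m*n p) pps∣nᵏ)
  ... | divides c refl = ℕ.*-monoˡ-∣ (product ps) p∣c
    where
    p⊥ps : Coprime p (product ps)
    p⊥ps {e} (e∣p , e∣ps) with prime⇒irreducible p-prime e∣p
    ... | inj₁ e≡1 = e≡1
    ... | inj₂ refl = ⊥-elim (sqf′ p p-prime (ℕ.*-monoʳ-∣ p e∣ps))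
    p∣c : p ℕ.∣ c
    p∣c = coprime-divisor p⊥ps (subst (p ℕ.∣_) (ℕ.*-comm c (product ps))
            (prime∣^⇒∣ p-prime (c * product ps) k (ℕ.∣-trans (ℕ.m∣m*n (product ps)) pps∣nᵏ)))

length-cartesianProductWith : ∀ {A B C : Set} (f : A → B → C) xs ys →
                              length (cartesianProductWith f xs ys) ≡ length xs * length ys
length-cartesianProductWith f [] ys = refl
length-cartesianProductWith f (x ∷ xs) ys = begin
  length (map (f x) ys ++ cartesianProductWith f xs ys)            ≡⟨ List.length-++ (map (f x) ys) ⟩
  length (map (f x) ys) + length (cartesianProductWith f xs ys)    ≡⟨ cong₂ _+_ (List.length-map (f x) ys) (length-cartesianProductWith f xs ys) ⟩
  length ys + length xs * length ys                                ∎
  where open ≡-Reasoning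

elements : ∀ {n} → Subset n → List (Fin n)
elements [] = []
elements (inside ∷ p) = Fin.zero ∷ map Fin.suc (elements p)
elements (outside ∷ p) = map Fin.suc (elements p)

length-elements : ∀ {n} (p : Subset n) → length (elements p) ≡ ∣ p ∣
length-elements [] = refl
length-elements (inside ∷ p) = cong suc (trans (List.length-map Fin.suc (elements p)) (length-elements p))
length-elements (outside ∷ p) = trans (List.length-map Fin.suc (elements p)) (length-elements p)

∈elements⇒∈ : ∀ {n} (p : Subset n) {i} → i ∈ₗ elements p → i ∈ p
∈elements⇒∈ (inside ∷ p) (hereₗ refl) = here
∈elements⇒∈ (inside ∷ p) (thereₗ i∈) with ∈-map⁻ Fin.suc i∈
... | _ , j∈ , refl = there (∈elements⇒∈ p j∈)
∈elements⇒∈ (outside ∷ p) i∈ with ∈-map⁻ Fin.suc i∈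
... | _ , j∈ , refl = there (∈elements⇒∈ p j∈)

elements-unique : ∀ {n} (p : Subset n) → Unique (elements p)
elements-unique [] = []
elements-unique (inside ∷ p) = All.tabulate zero∉ ∷ Unique.map⁺ Fin.suc-injective (elements-unique p)
  where
  zero∉ : ∀ {i} → i ∈ₗ map Fin.suc (elements p) → Fin.zero ≢ i
  zero∉ i∈ refl with ∈-map⁻ Fin.suc i∈
  ... | _ , _ , ()
elements-unique (outside ∷ p) = Unique.map⁺ Fin.suc-injective (elements-unique p)

length≤∣p∣ : ∀ {n} (p : Subset n) (xs : List ℕ) → Unique xs →
             All (λ x → Σ (Fin n) λ i → toℕ i ≡ x × i ∈ p) xs → length xs ≤ ∣ p ∣
length≤∣p∣ p [] _ _ = z≤n
length≤∣p∣ p (_ ∷ xs) (x∉xs ∷ xs-unique) ((i , refl , i∈p) ∷ xs⊆p) = begin-strict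
  length xs   ≤⟨ length≤∣p∣ (p - i) xs xs-unique (All.zipWith remove-i (x∉xs , xs⊆p)) ⟩
  ∣ p - i ∣   <⟨ x∈p⇒∣p-x∣<∣p∣ i∈p ⟩
  ∣ p ∣       ∎
  where
  open ℕ.≤-Reasoning
  remove-i : ∀ {y} → toℕ i ≢ y × (Σ (Fin _) λ j → toℕ j ≡ y × j ∈ p) → Σ (Fin _) λ j → toℕ j ≡ y × j ∈ p - i
  remove-i (i≢y , j , refl , j∈p) = j , refl , x∈p∧x≢y⇒x∈p-y j∈p (λ j≡i → i≢y (cong toℕ (sym j≡i)))

fromList : (N : ℕ) → List ℕ → Subset N
fromList N xs = tabulate (λ i → does (toℕ i ∈? xs))

lookup-fromList : ∀ {N} xs (i : Fin N) → lookup (fromList N xs) i ≡ does (toℕ i ∈? xs)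
lookup-fromList xs = Vec.lookup∘tabulate (λ i → does (toℕ i ∈? xs))

∈fromList⁻ : ∀ {N xs} {i : Fin N} → i ∈ fromList N xs → toℕ i ∈ₗ xs
∈fromList⁻ {xs = xs} {i} i∈ with toℕ i ∈? xs | trans (sym (lookup-fromList xs i)) (Vec.[]=⇒lookup i∈)
... | yes i∈xs | _ = i∈xs
... | no _ | ()

∈fromList⁺ : ∀ {N xs} (i : Fin N) → toℕ i ∈ₗ xs → i ∈ fromList N xs
∈fromList⁺ {xs = xs} i i∈xs = Vec.lookup⇒[]= i _ (trans (lookup-fromList xs i) (dec-true (toℕ i ∈? xs) i∈xs))

length≤∣fromList∣ : ∀ {N} xs → Unique xs → (∀ {x} → x ∈ₗ xs → x < N) → length xs ≤ ∣ fromList N xs ∣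
length≤∣fromList∣ {N} xs xs-unique xs<N = length≤∣p∣ (fromList N xs) xs xs-unique (All.tabulate member)
  where
  member : ∀ {x} → x ∈ₗ xs → Σ (Fin N) λ i → toℕ i ≡ x × i ∈ fromList N xs
  member x∈ = Fin.fromℕ< (xs<N x∈) , Fin.toℕ-fromℕ< _ ,
              ∈fromList⁺ _ (subst (_∈ₗ xs) (sym (Fin.toℕ-fromℕ< _)) x∈)

module Congruence (m : ℕ) .{{_ : NonZero m}} where

  -- a ≈ b is a ≡ b (mod m); a record rather than a synonym so that a and b can be inferred
  infix 4 _≈_
  record _≈_ (a b : ℤ) : Set where
    constructor ∣⇒≈
    field ≈⇒∣ : + m ∣ a ℤ.- b

  open _≈_ public

  ≈-sym : ∀ {a b} → a ≈ b → b ≈ a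
  ≈-sym {a} {b} (∣⇒≈ m∣a-b) = ∣⇒≈ (subst (+ m ∣_) (neg-minus a b) (ℤ.∣m⇒∣-m m∣a-b))
    where
    neg-minus : ∀ a b → ℤ.- (a ℤ.- b) ≡ b ℤ.- a
    neg-minus = ℤ-Solver.solve-∀

  ≈-trans : ∀ {a b c} → a ≈ b → b ≈ c → a ≈ c
  ≈-trans {a} {b} {c} (∣⇒≈ m∣a-b) (∣⇒≈ m∣b-c) = ∣⇒≈ (subst (+ m ∣_) (telescope a b c) (ℤ.∣m∣n⇒∣m+n m∣a-b m∣b-c))
    where
    telescope : ∀ a b c → (a ℤ.- b) ℤ.+ (b ℤ.- c) ≡ a ℤ.- c
    telescope = ℤ-Solver.solve-∀

  ≈-^ : ∀ {a b} k → a ≈ b → a ℤ.^ k ≈ b ℤ.^ k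
  ≈-^ zero _ = ∣⇒≈ (ℤ.divides (+ 0) refl)
  ≈-^ {a} {b} (suc k) a≈b = ∣⇒≈ (subst (+ m ∣_) (sym (split a b (a ℤ.^ k) (b ℤ.^ k)))
      (ℤ.∣m∣n⇒∣m+n (ℤ.∣n⇒∣m*n a (≈⇒∣ (≈-^ k a≈b))) (ℤ.∣m⇒∣m*n (b ℤ.^ k) (≈⇒∣ a≈b))))
    where
    split : ∀ a b x y → a ℤ.* x ℤ.- b ℤ.* y ≡ a ℤ.* (x ℤ.- y) ℤ.+ (a ℤ.- b) ℤ.* y
    split = ℤ-Solver.solve-∀

  ≈-flip : ∀ {a b c} → a ℤ.- b ≈ c → b ℤ.- a ≈ ℤ.- c
  ≈-flip {a} {b} {c} (∣⇒≈ m∣[a-b]-c) = ∣⇒≈ (subst (+ m ∣_) (negate a b c) (ℤ.∣m⇒∣-m m∣[a-b]-c))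
    where
    negate : ∀ a b c → ℤ.- ((a ℤ.- b) ℤ.- c) ≡ (b ℤ.- a) ℤ.- ℤ.- c
    negate = ℤ-Solver.solve-∀

  ≈-refl⇒∣ : ∀ {a b w} → a ≡ b → + a ℤ.- + b ≈ w → + m ∣ w
  ≈-refl⇒∣ {a} {w = w} refl (∣⇒≈ m∣[a-a]-w) =
    subst (+ m ∣_) (ℤ.neg-involutive w) (ℤ.∣m⇒∣-m (subst (+ m ∣_) (cancel (+ a) w) m∣[a-a]-w))
    where
    cancel : ∀ a w → (a ℤ.- a) ℤ.- w ≡ ℤ.- w
    cancel = ℤ-Solver.solve-∀

  %-≈ : ∀ n → + (n % m) ≈ + n
  %-≈ n = ∣⇒≈ (ℤ.divides (ℤ.- + (n / m)) (begin
    + (n % m) ℤ.- + n                           ≡⟨ cong (λ t → + (n % m) ℤ.- + t) (m≡m%n+[m/n]*n n m) ⟩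
    + (n % m) ℤ.- + (n % m + n / m * m)         ≡⟨ cong (λ t → + (n % m) ℤ.- t) (trans (ℤ.pos-+ (n % m) _) (cong (λ t → + (n % m) ℤ.+ t) (ℤ.pos-* (n / m) m))) ⟩
    + (n % m) ℤ.- (+ (n % m) ℤ.+ + (n / m) ℤ.* + m) ≡⟨ cancel (+ (n % m)) (+ (n / m)) (+ m) ⟩
    ℤ.- + (n / m) ℤ.* + m                        ∎))
    where
    open ≡-Reasoning
    cancel : ∀ r q d → r ℤ.- (r ℤ.+ q ℤ.* d) ≡ ℤ.- q ℤ.* d
    cancel = ℤ-Solver.solve-∀

  m-adic-decomposition : 1 < m → ∀ y → y ≢ + 0 → ∃₂ λ j z → y ≡ + (m ^ j) ℤ.* z × ¬ (+ m ∣ z)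
  m-adic-decomposition 1<m y = go y (On.wellFounded ℤ.∣_∣ <-wellFounded y)
    where
    go : ∀ y → Acc (ℕ._<_ on ℤ.∣_∣) y → y ≢ + 0 → ∃₂ λ j z → y ≡ + (m ^ j) ℤ.* z × ¬ (+ m ∣ z)
    go y _ y≢0 with + m ℤ.∣? y
    go y _ y≢0 | no m∤y = 0 , y , sym (ℤ.*-identityˡ y) , m∤y
    go y (acc rs) y≢0 | yes (ℤ.divides q refl) with go q (rs ∣q∣<∣q*m∣) q≢0
      where
      q≢0 : q ≢ + 0
      q≢0 refl = y≢0 refl
      ∣q∣<∣q*m∣ : ℤ.∣ q ∣ < ℤ.∣ q ℤ.* + m ∣
      ∣q∣<∣q*m∣ = subst (ℤ.∣ q ∣ <_) (sym (ℤ.abs-* q (+ m)))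
                    (ℕ.m<m*n ℤ.∣ q ∣ m {{ℕ.≢-nonZero (q≢0 ∘ ℤ.∣i∣≡0⇒i≡0)}} 1<m)
    ... | j , z , refl , m∤z = suc j , z , regroup , m∤z
      where
      regroup : + (m ^ j) ℤ.* z ℤ.* + m ≡ + (m ^ suc j) ℤ.* z
      regroup = trans (shuffle (+ (m ^ j)) z (+ m)) (cong (ℤ._* z) (sym (ℤ.pos-* m (m ^ j))))
        where
        shuffle : ∀ a b c → a ℤ.* b ℤ.* c ≡ c ℤ.* a ℤ.* b
        shuffle = ℤ-Solver.solve-∀

  ∤-^ : SquareFree m → ∀ {z} k → ¬ (+ m ∣ z) → ¬ (+ m ∣ z ℤ.^ k)
  ∤-^ sqf {z} k m∤z m∣zᵏ = m∤z (ℤ.∣ᵤ⇒∣ (squareFree-∣^⇒∣ sqf ℤ.∣ z ∣ k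
    (subst (m ℕ.∣_) (abs-^ z k) (ℤ.∣⇒∣ᵤ m∣zᵏ))))

module Digits (m : ℕ) .{{_ : NonZero m}} where

  open Congruence m

  digit : ℕ → ℕ → Fin m
  digit X zero = X mod m
  digit X (suc j) = digit (X / m) j

  toℕ-digit-+-*^ : ∀ X w j → toℕ (digit (X + m ^ j * w) j) ≡ (toℕ (digit X j) + w) % m
  toℕ-digit-+-*^ X w zero = begin
    toℕ ((X + 1 * w) mod m)    ≡⟨ Fin.toℕ-fromℕ< _ ⟩
    (X + 1 * w) % m            ≡⟨ cong (λ t → (X + t) % m) (ℕ.*-identityˡ w) ⟩
    (X + w) % m                ≡⟨ %-distribˡ-+ X w m ⟩
    (X % m + w % m) % m        ≡⟨ cong (λ t → (t + w % m) % m) (m%n%n≡m%n X m) ⟨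
    (X % m % m + w % m) % m    ≡⟨ %-distribˡ-+ (X % m) w m ⟨
    (X % m + w) % m            ≡⟨ cong (λ t → (t + w) % m) (Fin.toℕ-fromℕ< _) ⟨
    (toℕ (X mod m) + w) % m    ∎
    where open ≡-Reasoning
  toℕ-digit-+-*^ X w (suc j) = trans (cong (λ t → toℕ (digit t j)) quotient) (toℕ-digit-+-*^ (X / m) w j)
    where
    quotient : (X + m ^ suc j * w) / m ≡ X / m + m ^ j * w
    quotient = begin
      (X + m * m ^ j * w) / m    ≡⟨ cong (λ t → (X + t) / m) (rotate m (m ^ j) w) ⟩
      (X + m ^ j * w * m) / m    ≡⟨ +-distrib-/-∣ʳ X (divides-refl (m ^ j * w)) ⟩
      X / m + m ^ j * w * m / m  ≡⟨ cong (λ t → X / m + t) (m*n/n≡m (m ^ j * w) m) ⟩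
      X / m + m ^ j * w          ∎
      where
      open ≡-Reasoning
      rotate : ∀ a b c → a * b * c ≡ b * c * a
      rotate = ℕ-Solver.solve-∀

  toℕ-digit-< : ∀ {X} j → X < m ^ j → toℕ (digit X j) ≡ 0
  toℕ-digit-< {zero} zero _ = trans (Fin.toℕ-fromℕ< _) (m<n⇒m%n≡m (ℕ.>-nonZero⁻¹ m))
  toℕ-digit-< {suc X} zero (s≤s ())
  toℕ-digit-< {X} (suc j) X<m^[1+j] =
    toℕ-digit-< j (m<n*o⇒m/o<n (subst (X <_) (ℕ.*-comm m (m ^ j)) X<m^[1+j]))

  infixr 5 _∷ᵈ_
  _∷ᵈ_ : Fin m → ℕ → ℕ
  d ∷ᵈ X = toℕ d + X * m

  digit-∷ᵈ-zero : ∀ d X → digit (d ∷ᵈ X) 0 ≡ d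
  digit-∷ᵈ-zero d X = Fin.toℕ-injective (begin
    toℕ ((toℕ d + X * m) mod m) ≡⟨ Fin.toℕ-fromℕ< _ ⟩
    (toℕ d + X * m) % m         ≡⟨ [m+kn]%n≡m%n (toℕ d) X m ⟩
    toℕ d % m                   ≡⟨ m<n⇒m%n≡m (Fin.toℕ<n d) ⟩
    toℕ d                       ∎)
    where open ≡-Reasoning

  ∷ᵈ-/ : ∀ d X → (d ∷ᵈ X) / m ≡ X
  ∷ᵈ-/ d X = begin
    (toℕ d + X * m) / m     ≡⟨ +-distrib-/-∣ʳ (toℕ d) (divides-refl X) ⟩
    toℕ d / m + X * m / m   ≡⟨ cong₂ _+_ (m<n⇒m/n≡0 (Fin.toℕ<n d)) (m*n/n≡m X m) ⟩
    X                       ∎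
    where open ≡-Reasoning

  digit-∷ᵈ-suc : ∀ d X j → digit (d ∷ᵈ X) (suc j) ≡ digit X j
  digit-∷ᵈ-suc d X j = cong (λ t → digit t j) (∷ᵈ-/ d X)

  ∷ᵈ-injective : ∀ {d d′ X X′} → d ∷ᵈ X ≡ d′ ∷ᵈ X′ → d ≡ d′ × X ≡ X′
  ∷ᵈ-injective {d} {d′} {X} {X′} eq =
    trans (sym (digit-∷ᵈ-zero d X)) (trans (cong (λ t → digit t 0) eq) (digit-∷ᵈ-zero d′ X′)) ,
    trans (sym (∷ᵈ-/ d X)) (trans (cong (_/ m) eq) (∷ᵈ-/ d′ X′))

  ∷ᵈ-< : ∀ d {X} D → X < m ^ D → d ∷ᵈ X < m ^ suc D
  ∷ᵈ-< d {X} D X<m^D = begin-strict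
    toℕ d + X * m    <⟨ ℕ.+-monoˡ-< (X * m) (Fin.toℕ<n d) ⟩
    suc X * m        ≤⟨ ℕ.*-monoˡ-≤ m X<m^D ⟩
    m ^ D * m        ≡⟨ ℕ.*-comm (m ^ D) m ⟩
    m ^ suc D        ∎
    where open ℕ.≤-Reasoning

  digit-+-*^-≈ : ∀ X w j → + toℕ (digit (X + m ^ j * w) j) ℤ.- + toℕ (digit X j) ≈ + w
  digit-+-*^-≈ X w j rewrite toℕ-digit-+-*^ X w j =
    ∣⇒≈ (subst (+ m ∣_) (trans (cong (λ t → + ((d + w) % m) ℤ.- t) (ℤ.pos-+ d w)) (regroup (+ ((d + w) % m)) (+ d) (+ w)))
      (≈⇒∣ (%-≈ (d + w))))
    where
    d = toℕ (digit X j)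
    regroup : ∀ a b c → a ℤ.- (b ℤ.+ c) ≡ (a ℤ.- b) ℤ.- c
    regroup = ℤ-Solver.solve-∀

  digit-≈ : ∀ {X Y} j z → + Y ≡ + X ℤ.+ + (m ^ j) ℤ.* z →
            + toℕ (digit Y j) ℤ.- + toℕ (digit X j) ≈ z
  digit-≈ {X} {Y} j (+ w) Y≡X+mʲw =
    subst (λ t → + toℕ (digit t j) ℤ.- + toℕ (digit X j) ≈ + w) (sym Y≡X+mʲw′) (digit-+-*^-≈ X w j)
    where
    Y≡X+mʲw′ : Y ≡ X + m ^ j * w
    Y≡X+mʲw′ = ℤ.+-injective (trans Y≡X+mʲw (sym (pos-+-* X (m ^ j) w)))
  digit-≈ {X} {Y} j -[1+ w ] Y≡X+mʲz =
    subst (λ t → + toℕ (digit Y j) ℤ.- + toℕ (digit t j) ≈ -[1+ w ]) (sym X≡Y+mʲ[1+w])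
      (≈-flip {+ toℕ (digit (Y + m ^ j * suc w) j)} {+ toℕ (digit Y j)} (digit-+-*^-≈ Y (suc w) j))
    where
    open ≡-Reasoning
    a = + (m ^ j)
    cancel : ∀ x a s → x ≡ (x ℤ.+ a ℤ.* ℤ.- s) ℤ.+ a ℤ.* s
    cancel = ℤ-Solver.solve-∀
    X≡Y+mʲ[1+w] : X ≡ Y + m ^ j * suc w
    X≡Y+mʲ[1+w] = ℤ.+-injective (begin
      + X                                          ≡⟨ cancel (+ X) a (+ suc w) ⟩
      (+ X ℤ.+ a ℤ.* -[1+ w ]) ℤ.+ a ℤ.* + suc w   ≡⟨ cong (λ t → t ℤ.+ a ℤ.* + suc w) Y≡X+mʲz ⟨
      + Y ℤ.+ a ℤ.* + suc w                         ≡⟨ pos-+-* Y (m ^ j) (suc w) ⟨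
      + (Y + m ^ j * suc w)                         ∎)

  HasDigitsIn : (ℕ → Subset m) → ℕ → ℕ → Set
  HasDigitsIn S D X = X < m ^ D × (∀ j → j < D → digit X j ∈ S j)

  withDigitsIn : (ℕ → Subset m) → ℕ → List ℕ
  withDigitsIn S zero = [ 0 ]
  withDigitsIn S (suc D) = cartesianProductWith _∷ᵈ_ (elements (S 0)) (withDigitsIn (S ∘ suc) D)

  length-withDigitsIn : ∀ S D → length (withDigitsIn S D) ≡ product (applyUpTo (∣_∣ ∘ S) D)
  length-withDigitsIn S zero = refl
  length-withDigitsIn S (suc D) = trans (length-cartesianProductWith _∷ᵈ_ (elements (S 0)) _)
    (cong₂ _*_ (length-elements (S 0)) (length-withDigitsIn (S ∘ suc) D))

  withDigitsIn-unique : ∀ S D → Unique (withDigitsIn S D)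
  withDigitsIn-unique S zero = [] ∷ []
  withDigitsIn-unique S (suc D) =
    Unique.cartesianProductWith⁺ _∷ᵈ_ ∷ᵈ-injective (elements-unique (S 0)) (withDigitsIn-unique (S ∘ suc) D)

  ∈withDigitsIn⇒ : ∀ S D {X} → X ∈ₗ withDigitsIn S D → HasDigitsIn S D X
  ∈withDigitsIn⇒ S zero (hereₗ refl) = s≤s z≤n , λ _ ()
  ∈withDigitsIn⇒ S (suc D) X∈ with ∈-cartesianProductWith⁻ _∷ᵈ_ (elements (S 0)) _ X∈
  ... | d , X′ , d∈ , X′∈ , refl with ∈withDigitsIn⇒ (S ∘ suc) D X′∈
  ...   | X′<mᴰ , digits = ∷ᵈ-< d D X′<mᴰ , digits′
    where
    digits′ : ∀ j → j < suc D → digit (d ∷ᵈ X′) j ∈ S j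
    digits′ zero _ = subst (_∈ S 0) (sym (digit-∷ᵈ-zero d X′)) (∈elements⇒∈ (S 0) d∈)
    digits′ (suc j) (s≤s j<D) = subst (_∈ S (suc j)) (sym (digit-∷ᵈ-suc d X′ j)) (digits j j<D)

  -- Admissible m k R unfolds to ∀ n → PowerSeparated k (R (suc n)) (R n)
  PowerSeparated : ℕ → Subset m → Subset m → Set
  PowerSeparated k T U =
    ∀ (r r′ s s′ : Fin m) → r ∈ T → r′ ∈ T → r ≢ r′ → s ∈ U → s′ ∈ U →
    ¬ ((+ m) ℤᵤ.∣ ((res r ℤ.- res r′) ℤ.- ((res s ℤ.- res s′) ℤ.^ k)))

  module _ {S : ℕ → Subset m} {D : ℕ} where

    digits-differ : ∀ {X X′} → HasDigitsIn S D X → HasDigitsIn S D X′ → ∀ j {w} → ¬ (+ m ∣ w) →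
                    + toℕ (digit X′ j) ℤ.- + toℕ (digit X j) ≈ w → j < D × digit X′ j ≢ digit X j
    digits-differ (X<mᴰ , _) (X′<mᴰ , _) j m∤w dX′-dX≈w with ℕ.<-≤-connex j D
    ... | inj₁ j<D = j<D , λ eq → m∤w (≈-refl⇒∣ (cong toℕ eq) dX′-dX≈w)
    ... | inj₂ D≤j = ⊥-elim (m∤w (≈-refl⇒∣ (trans (vanish X′<mᴰ) (sym (vanish X<mᴰ))) dX′-dX≈w))
      where
      vanish : ∀ {Y} → Y < m ^ D → toℕ (digit Y j) ≡ 0
      vanish Y<mᴰ = toℕ-digit-< j (ℕ.<-≤-trans Y<mᴰ (ℕ.^-monoʳ-≤ m D≤j))

  module _ (sqf : SquareFree m) (k : ℕ) {S : ℕ → Subset m} {D : ℕ}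
           (S₀-trivial : ∀ {d d′} → d ∈ S 0 → d′ ∈ S 0 → d ≡ d′)
           (separated : ∀ j → PowerSeparated k (S (suc j * k)) (S (suc j)))
           {X₀ X₁ X₂ : ℕ} (h₀ : HasDigitsIn S D X₀) (h₁ : HasDigitsIn S D X₁) (h₂ : HasDigitsIn S D X₂) where

    no-pattern-at-scale : ∀ j z → ¬ (+ m ∣ z) →
                          + X₁ ≡ + X₀ ℤ.+ + (m ^ j) ℤ.* z → + X₂ ≡ + X₀ ℤ.+ + (m ^ (j * k)) ℤ.* z ℤ.^ k → ⊥
    no-pattern-at-scale j z m∤z X₁≡ X₂≡
      with digits-differ h₀ h₁ j m∤z (digit-≈ j z X₁≡)
         | digits-differ h₀ h₂ (j * k) (∤-^ sqf k m∤z) (digit-≈ (j * k) (z ℤ.^ k) X₂≡)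
    no-pattern-at-scale zero z m∤z X₁≡ X₂≡ | 0<D , d₁≢d₀ | _ =
      d₁≢d₀ (S₀-trivial (proj₂ h₁ 0 0<D) (proj₂ h₀ 0 0<D))
    no-pattern-at-scale (suc j) z m∤z X₁≡ X₂≡ | j<D , _ | jk<D , e₂≢e₀ =
      separated j (digit X₂ (suc j * k)) (digit X₀ (suc j * k)) (digit X₁ (suc j)) (digit X₀ (suc j))
        (proj₂ h₂ _ jk<D) (proj₂ h₀ _ jk<D) e₂≢e₀ (proj₂ h₁ _ j<D) (proj₂ h₀ _ j<D)
        (ℤ.∣⇒∣ᵤ (≈⇒∣ (≈-trans (digit-≈ (suc j * k) (z ℤ.^ k) X₂≡) (≈-sym (≈-^ k (digit-≈ (suc j) z X₁≡))))))

    no-pattern : 1 < m → ∀ y → y ≢ + 0 → + X₁ ≡ + X₀ ℤ.+ y → + X₂ ≡ + X₀ ℤ.+ y ℤ.^ k → ⊥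
    no-pattern 1<m y y≢0 X₁≡ X₂≡ with m-adic-decomposition 1<m y y≢0
    ... | j , z , refl , m∤z = no-pattern-at-scale j z m∤z X₁≡ (trans X₂≡ (cong (λ t → + X₀ ℤ.+ t) mʲzᵏ))
      where
      mʲzᵏ : (+ (m ^ j) ℤ.* z) ℤ.^ k ≡ + (m ^ (j * k)) ℤ.* z ℤ.^ k
      mʲzᵏ = trans (ℤ-^-distrib-* (+ (m ^ j)) z k)
               (cong (ℤ._* z ℤ.^ k) (trans (sym (pos-^ (m ^ j) k)) (cong +_ (ℕ.^-*-assoc m j k))))

module Valuation (k-1 : ℕ) .{{_ : NonZero k-1}} where

  k : ℕ
  k = suc k-1

  1<k : 1 < k
  1<k = s≤s (ℕ.>-nonZero⁻¹ k-1)

  -- ν fuel n is the k-adic valuation of n ≥ 1 as soon as fuel ≥ n; v 0 = 0 is junk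
  ν : ℕ → ℕ → ℕ
  ν zero _ = 0
  ν (suc fuel) zero = 0
  ν (suc fuel) n@(suc _) with k ℕ.∣? n
  ... | yes _ = suc (ν fuel (n / k))
  ... | no _ = 0

  v : ℕ → ℕ
  v n = ν n n

  ν-zero : ∀ fuel → ν fuel 0 ≡ 0
  ν-zero zero = refl
  ν-zero (suc fuel) = refl

  ν-∣ : ∀ fuel n → k ℕ.∣ suc n → ν (suc fuel) (suc n) ≡ suc (ν fuel (suc n / k))
  ν-∣ fuel n k∣n with k ℕ.∣? suc n
  ... | yes _ = refl
  ... | no k∤n = ⊥-elim (k∤n k∣n)

  ν-∤ : ∀ fuel n → ¬ k ℕ.∣ suc n → ν (suc fuel) (suc n) ≡ 0
  ν-∤ fuel n k∤n with k ℕ.∣? suc n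
  ... | yes k∣n = ⊥-elim (k∤n k∣n)
  ... | no _ = refl

  ν-fuel : ∀ {fuel fuel′} n → n ≤ fuel → n ≤ fuel′ → ν fuel n ≡ ν fuel′ n
  ν-fuel {fuel} {fuel′} zero _ _ = trans (ν-zero fuel) (sym (ν-zero fuel′))
  ν-fuel {suc fuel} {suc fuel′} (suc n) (s≤s n≤fuel) (s≤s n≤fuel′) with k ℕ.∣? suc n
  ... | yes _ = cong suc (ν-fuel (suc n / k) (ℕ.≤-trans n/k≤n n≤fuel) (ℕ.≤-trans n/k≤n n≤fuel′))
    where
    n/k≤n : suc n / k ≤ n
    n/k≤n = ℕ.≤-pred (m/n<m (suc n) k 1<k)
  ... | no _ = refl

  v-*k : ∀ n → v (suc n * k) ≡ suc (v (suc n))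
  v-*k n = begin
    ν (suc n * k) (suc n * k)                ≡⟨ ν-∣ (k-1 + n * k) (k-1 + n * k) (ℕ.n∣m*n (suc n)) ⟩
    suc (ν (k-1 + n * k) (suc n * k / k))    ≡⟨ cong (suc ∘ ν (k-1 + n * k)) (m*n/n≡m (suc n) k) ⟩
    suc (ν (k-1 + n * k) (suc n))            ≡⟨ cong suc (ν-fuel (suc n) 1+n≤k-1+n*k ℕ.≤-refl) ⟩
    suc (v (suc n))                          ∎
    where
    open ≡-Reasoning
    1+n≤k-1+n*k : suc n ≤ k-1 + n * k
    1+n≤k-1+n*k = ℕ.+-mono-≤ (ℕ.>-nonZero⁻¹ k-1) (ℕ.m≤m*n n k)

  v-∤ : ∀ n → ¬ k ℕ.∣ suc n → v (suc n) ≡ 0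
  v-∤ n = ν-∤ n n

  ∏ᵥ : (ℕ → ℕ) → ℕ → ℕ
  ∏ᵥ g X = product (applyUpTo (λ j → g (v (suc j))) X)

  ∏ᵥ-suc : ∀ g X → ∏ᵥ g (suc X) ≡ ∏ᵥ g X * g (v (suc X))
  ∏ᵥ-suc g X = begin
    product (applyUpTo f (suc X))          ≡⟨ cong product (List.applyUpTo-∷ʳ f X) ⟨
    product (applyUpTo f X ++ [ f X ])     ≡⟨ product-++ (applyUpTo f X) [ f X ] ⟩
    ∏ᵥ g X * (f X * 1)                     ≡⟨ cong (∏ᵥ g X *_) (ℕ.*-identityʳ (f X)) ⟩
    ∏ᵥ g X * f X                           ∎
    where
    open ≡-Reasoning
    f = λ j → g (v (suc j))

  ∏ᵥ-positive : ∀ g → (∀ n → 1 ≤ g n) → ∀ X → 1 ≤ ∏ᵥ g X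
  ∏ᵥ-positive g g>0 zero = ℕ.≤-refl
  ∏ᵥ-positive g g>0 (suc X) = subst (1 ≤_) (sym (∏ᵥ-suc g X)) (ℕ.*-mono-≤ (∏ᵥ-positive g g>0 X) (g>0 _))

  -- Among 1, …, r + Y k exactly Y positions are multiples of k, namely j k with j ≤ Y,
  -- and v (j k) = 1 + v j.
  ∏ᵥ-split : ∀ g Y r → r < k → ∏ᵥ g (r + Y * k) ≡ g 0 ^ (r + Y * k-1) * ∏ᵥ (g ∘ suc) Y
  ∏ᵥ-split g zero zero _ = refl
  ∏ᵥ-split g (suc Y) zero _ = begin
    ∏ᵥ g (suc (k-1 + Y * k))                                       ≡⟨ ∏ᵥ-suc g (k-1 + Y * k) ⟩
    ∏ᵥ g (k-1 + Y * k) * g (v (suc Y * k))                         ≡⟨ cong₂ _*_ (∏ᵥ-split g Y k-1 ℕ.≤-refl) (cong g (v-*k Y)) ⟩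
    g 0 ^ (k-1 + Y * k-1) * ∏ᵥ (g ∘ suc) Y * g (suc (v (suc Y)))  ≡⟨ ℕ.*-assoc (g 0 ^ (k-1 + Y * k-1)) _ _ ⟩
    g 0 ^ (k-1 + Y * k-1) * (∏ᵥ (g ∘ suc) Y * g (suc (v (suc Y)))) ≡⟨ cong (g 0 ^ (k-1 + Y * k-1) *_) (∏ᵥ-suc (g ∘ suc) Y) ⟨
    g 0 ^ (k-1 + Y * k-1) * ∏ᵥ (g ∘ suc) (suc Y)                    ∎
    where open ≡-Reasoning
  ∏ᵥ-split g Y (suc r) 1+r<k = begin
    ∏ᵥ g (suc (r + Y * k))                                 ≡⟨ ∏ᵥ-suc g (r + Y * k) ⟩
    ∏ᵥ g (r + Y * k) * g (v (suc (r + Y * k)))             ≡⟨ cong₂ _*_ (∏ᵥ-split g Y r (ℕ.<⇒≤ 1+r<k)) (cong g (v-∤ (r + Y * k) k∤)) ⟩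
    g 0 ^ (r + Y * k-1) * ∏ᵥ (g ∘ suc) Y * g 0             ≡⟨ rotate (g 0 ^ (r + Y * k-1)) (∏ᵥ (g ∘ suc) Y) (g 0) ⟩
    g 0 ^ suc (r + Y * k-1) * ∏ᵥ (g ∘ suc) Y               ∎
    where
    open ≡-Reasoning
    rotate : ∀ a b c → a * b * c ≡ c * a * b
    rotate = ℕ-Solver.solve-∀
    k∤ : ¬ k ℕ.∣ suc r + Y * k
    k∤ k∣ = ℕ.<⇒≱ 1+r<k (ℕ.∣⇒≤ (ℕ.∣m+n∣m⇒∣n (subst (k ℕ.∣_) (ℕ.+-comm (suc r) (Y * k)) k∣) (ℕ.n∣m*n Y)))

  module _ {m : ℕ} where

    P-suc : ∀ (R : ℕ → Subset m) M → P m k R (suc M) ≡ ∣ R 0 ∣ ^ (k ^ M) * P m k (R ∘ suc) M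
    P-suc R zero = begin
      1 ^ k * ∣ R 0 ∣     ≡⟨ cong (_* ∣ R 0 ∣) (ℕ.^-zeroˡ k) ⟩
      1 * ∣ R 0 ∣         ≡⟨ ℕ.*-identityˡ _ ⟩
      ∣ R 0 ∣             ≡⟨ ℕ.^-identityʳ _ ⟨
      ∣ R 0 ∣ ^ 1         ≡⟨ ℕ.*-identityʳ _ ⟨
      ∣ R 0 ∣ ^ 1 * 1     ∎
      where open ≡-Reasoning
    P-suc R (suc M) = begin
      P m k R (suc M) ^ k * ∣ R (suc M) ∣                  ≡⟨ cong (λ t → t ^ k * ∣ R (suc M) ∣) (P-suc R M) ⟩
      (r₀ ^ K * P′) ^ k * ∣ R (suc M) ∣                     ≡⟨ cong (_* ∣ R (suc M) ∣) (^-distrib-* (r₀ ^ K) P′ k) ⟩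
      (r₀ ^ K) ^ k * P′ ^ k * ∣ R (suc M) ∣                 ≡⟨ cong (λ t → t * P′ ^ k * ∣ R (suc M) ∣) ([a^m]^n≡a^[n*m] r₀ K k) ⟩
      r₀ ^ (k * K) * P′ ^ k * ∣ R (suc M) ∣                 ≡⟨ ℕ.*-assoc (r₀ ^ (k * K)) _ _ ⟩
      r₀ ^ (k * K) * (P′ ^ k * ∣ R (suc M) ∣)               ∎
      where
      open ≡-Reasoning
      r₀ = ∣ R 0 ∣
      K = k ^ M
      P′ = P m k (R ∘ suc) M

    P^[k-1]≤ : .{{_ : NonZero m}} → ∀ (R : ℕ → Subset m) M → P m k R M ^ k-1 ≤ m ^ (k ^ M)
    P^[k-1]≤ R zero = subst (_≤ m ^ 1) (sym (ℕ.^-zeroˡ k-1)) (ℕ.m^n>0 m 1)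
    P^[k-1]≤ R (suc M) = begin
      P m k R (suc M) ^ k-1                 ≡⟨ cong (_^ k-1) (P-suc R M) ⟩
      (∣ R 0 ∣ ^ K * P′) ^ k-1              ≡⟨ ^-distrib-* (∣ R 0 ∣ ^ K) P′ k-1 ⟩
      (∣ R 0 ∣ ^ K) ^ k-1 * P′ ^ k-1        ≤⟨ ℕ.*-mono-≤ (ℕ.^-monoˡ-≤ k-1 (ℕ.^-monoˡ-≤ K (∣p∣≤n (R 0)))) (P^[k-1]≤ (R ∘ suc) M) ⟩
      (m ^ K) ^ k-1 * m ^ K                 ≡⟨ cong (_* m ^ K) (ℕ.^-*-assoc m K k-1) ⟩
      m ^ (K * k-1) * m ^ K                 ≡⟨ ℕ.^-distribˡ-+-* m (K * k-1) K ⟨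
      m ^ (K * k-1 + K)                     ≡⟨ cong (m ^_) (regroup K k-1) ⟩
      m ^ (k * K)                           ∎
      where
      open ℕ.≤-Reasoning
      K = k ^ M
      P′ = P m k (R ∘ suc) M
      regroup : ∀ K k-1 → K * k-1 + K ≡ suc k-1 * K
      regroup = ℕ-Solver.solve-∀

    P^[k-1]^X≤-step : .{{_ : NonZero m}} → ∀ (R : ℕ → Subset m) → 1 ≤ ∣ R 0 ∣ → ∀ M e r Y → r < k →
                      (P m k (R ∘ suc) M ^ k-1) ^ Y ≤ (∏ᵥ (∣_∣ ∘ R ∘ suc) Y * m ^ e) ^ (k ^ M) →
                      (P m k R (suc M) ^ k-1) ^ (r + Y * k) ≤ (∏ᵥ (∣_∣ ∘ R) (r + Y * k) * m ^ suc e) ^ (k ^ suc M)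
    P^[k-1]^X≤-step R r₀>0 M e r Y r<k T′ʸ≤ = begin
      (P m k R (suc M) ^ k-1) ^ (r + Y * k)                  ≡⟨ cong (λ t → (t ^ k-1) ^ (r + Y * k)) (P-suc R M) ⟩
      ((r₀ ^ K * P m k (R ∘ suc) M) ^ k-1) ^ (r + Y * k)     ≡⟨ cong (_^ (r + Y * k)) (^-distrib-* (r₀ ^ K) _ k-1) ⟩
      ((r₀ ^ K) ^ k-1 * T′) ^ (r + Y * k)                    ≡⟨ ^-distrib-* ((r₀ ^ K) ^ k-1) T′ (r + Y * k) ⟩
      ((r₀ ^ K) ^ k-1) ^ (r + Y * k) * T′ ^ (r + Y * k)      ≡⟨ cong (((r₀ ^ K) ^ k-1) ^ (r + Y * k) *_) T′-split ⟩
      ((r₀ ^ K) ^ k-1) ^ (r + Y * k) * (T′ ^ r * (T′ ^ Y) ^ k)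
        ≤⟨ ℕ.*-mono-≤ r₀-part (ℕ.*-mono-≤ T′ʳ≤ T′ʸᵏ≤) ⟩
      (r₀ ^ (r + Y * k-1)) ^ n * (m ^ n * (∏′ * m ^ e) ^ n)  ≡⟨ cong ((r₀ ^ (r + Y * k-1)) ^ n *_) (^-distrib-* m _ n) ⟨
      (r₀ ^ (r + Y * k-1)) ^ n * (m * (∏′ * m ^ e)) ^ n      ≡⟨ ^-distrib-* _ _ n ⟨
      (r₀ ^ (r + Y * k-1) * (m * (∏′ * m ^ e))) ^ n          ≡⟨ cong (_^ n) regroup ⟩
      (∏ᵥ (∣_∣ ∘ R) (r + Y * k) * m ^ suc e) ^ n             ∎
      where
      open ℕ.≤-Reasoning
      r₀ = ∣ R 0 ∣
      K = k ^ M
      n = k * K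
      T′ = P m k (R ∘ suc) M ^ k-1
      ∏′ = ∏ᵥ (∣_∣ ∘ R ∘ suc) Y
      T′-split : T′ ^ (r + Y * k) ≡ T′ ^ r * (T′ ^ Y) ^ k
      T′-split = trans (ℕ.^-distribˡ-+-* T′ r (Y * k)) (cong (T′ ^ r *_) (sym (ℕ.^-*-assoc T′ Y k)))
      exponent : ∀ K k-1 r Y → K * k-1 * (r + Y * suc k-1) + K * r ≡ (r + Y * k-1) * (suc k-1 * K)
      exponent = ℕ-Solver.solve-∀
      r₀-part : ((r₀ ^ K) ^ k-1) ^ (r + Y * k) ≤ (r₀ ^ (r + Y * k-1)) ^ n
      r₀-part = begin
        ((r₀ ^ K) ^ k-1) ^ (r + Y * k)   ≡⟨ trans (cong (_^ (r + Y * k)) (ℕ.^-*-assoc r₀ K k-1)) (ℕ.^-*-assoc r₀ (K * k-1) _) ⟩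
        r₀ ^ (K * k-1 * (r + Y * k))     ≤⟨ ℕ.^-monoʳ-≤ r₀ {{ℕ.>-nonZero r₀>0}} (subst (K * k-1 * (r + Y * k) ≤_) (exponent K k-1 r Y) (ℕ.m≤m+n _ (K * r))) ⟩
        r₀ ^ ((r + Y * k-1) * n)         ≡⟨ ℕ.^-*-assoc r₀ (r + Y * k-1) n ⟨
        (r₀ ^ (r + Y * k-1)) ^ n         ∎
      T′ʳ≤ : T′ ^ r ≤ m ^ n
      T′ʳ≤ = begin
        T′ ^ r          ≤⟨ ℕ.^-monoˡ-≤ r (P^[k-1]≤ (R ∘ suc) M) ⟩
        (m ^ K) ^ r     ≤⟨ ℕ.^-monoʳ-≤ (m ^ K) {{ℕ.m^n≢0 m K}} (ℕ.<⇒≤ r<k) ⟩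
        (m ^ K) ^ k     ≡⟨ [a^m]^n≡a^[n*m] m K k ⟩
        m ^ n           ∎
      T′ʸᵏ≤ : (T′ ^ Y) ^ k ≤ (∏′ * m ^ e) ^ n
      T′ʸᵏ≤ = ℕ.≤-trans (ℕ.^-monoˡ-≤ k T′ʸ≤) (ℕ.≤-reflexive ([a^m]^n≡a^[n*m] _ K k))
      shuffle : ∀ a b c d → a * (b * (c * d)) ≡ a * c * (b * d)
      shuffle = ℕ-Solver.solve-∀
      regroup : r₀ ^ (r + Y * k-1) * (m * (∏′ * m ^ e)) ≡ ∏ᵥ (∣_∣ ∘ R) (r + Y * k) * m ^ suc e
      regroup = trans (shuffle (r₀ ^ (r + Y * k-1)) m ∏′ (m ^ e))
                      (cong (_* m ^ suc e) (sym (∏ᵥ-split (∣_∣ ∘ R) Y r r<k)))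

    -- In logarithms: X · S_M ≤ log_m (∏ᵥ ∣R∣ X) + e, where S_M = (k-1) Σ_{n<M} log_m ∣R n∣ / k^(n+1)
    -- is the M-th partial sum of γ (cf. P in Defs).
    P^[k-1]^X≤ : .{{_ : NonZero m}} → ∀ (R : ℕ → Subset m) → (∀ n → 1 ≤ ∣ R n ∣) →
                 ∀ M X e → X < k ^ e → (P m k R M ^ k-1) ^ X ≤ (∏ᵥ (∣_∣ ∘ R) X * m ^ e) ^ (k ^ M)
    P^[k-1]^X≤ R R>0 zero X e _ = begin
      (1 ^ k-1) ^ X                        ≡⟨ trans (cong (_^ X) (ℕ.^-zeroˡ k-1)) (ℕ.^-zeroˡ X) ⟩
      1                                    ≤⟨ ℕ.*-mono-≤ (ℕ.*-mono-≤ (∏ᵥ-positive (∣_∣ ∘ R) R>0 X) (ℕ.m^n>0 m e)) ℕ.≤-refl ⟩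
      (∏ᵥ (∣_∣ ∘ R) X * m ^ e) ^ 1         ∎
      where open ℕ.≤-Reasoning
    P^[k-1]^X≤ R R>0 (suc M) zero zero _ = ℕ.≤-reflexive (sym (ℕ.^-zeroˡ (k ^ suc M)))
    P^[k-1]^X≤ R R>0 (suc M) (suc X) zero (s≤s ())
    P^[k-1]^X≤ R R>0 (suc M) X (suc e) X<k^[1+e] =
      subst (λ X → (P m k R (suc M) ^ k-1) ^ X ≤ (∏ᵥ (∣_∣ ∘ R) X * m ^ suc e) ^ (k ^ suc M))
        (sym (m≡m%n+[m/n]*n X k))
        (P^[k-1]^X≤-step R (R>0 0) M e (X % k) Y (m%n<n X k)
          (P^[k-1]^X≤ (R ∘ suc) (R>0 ∘ suc) M Y e (m<n*o⇒m/o<n (subst (X <_) (ℕ.*-comm k (k ^ e)) X<k^[1+e]))))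
      where
      Y = X / k

module _ (m : ℕ) .{{_ : NonZero m}} where

  exponent-< : 1 < m → ∀ {T K a b} → T ≤ m ^ K → m ^ (a * K) < T ^ b → a < b
  exponent-< 1<m {T} {K} {a} {b} T≤mᴷ mᵃᴷ<Tᵇ =
    ℕ.*-cancelʳ-< K a b (subst (a * K <_) (ℕ.*-comm K b) (^-cancelʳ-< m 1<m (begin-strict
      m ^ (a * K)   <⟨ mᵃᴷ<Tᵇ ⟩
      T ^ b         ≤⟨ ℕ.^-monoˡ-≤ b T≤mᴷ ⟩
      (m ^ K) ^ b   ≡⟨ ℕ.^-*-assoc m K b ⟩
      m ^ (K * b)   ∎)))
    where open ℕ.≤-Reasoning

  ^-transfer : ∀ T C K .{{_ : NonZero K}} a b X → m ^ (a * K) ≤ T ^ b → T ^ X ≤ C ^ K → m ^ (a * X) ≤ C ^ b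
  ^-transfer T C K a b X mᵃᴷ≤Tᵇ Tˣ≤Cᴷ = ^-cancelˡ-≤ K (begin
    (m ^ (a * X)) ^ K   ≡⟨ cong (_^ K) (ℕ.^-*-assoc m a X) ⟨
    ((m ^ a) ^ X) ^ K   ≡⟨ [a^m]^n≡[a^n]^m (m ^ a) X K ⟩
    ((m ^ a) ^ K) ^ X   ≡⟨ cong (_^ X) (ℕ.^-*-assoc m a K) ⟩
    (m ^ (a * K)) ^ X   ≤⟨ ℕ.^-monoˡ-≤ X mᵃᴷ≤Tᵇ ⟩
    (T ^ b) ^ X         ≡⟨ [a^m]^n≡[a^n]^m T b X ⟩
    (T ^ X) ^ b         ≤⟨ ℕ.^-monoˡ-≤ b Tˣ≤Cᴷ ⟩
    (C ^ K) ^ b         ≡⟨ [a^m]^n≡[a^n]^m C K b ⟩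
    (C ^ b) ^ K         ∎)
    where open ℕ.≤-Reasoning

  -- The counting loss m^(e · b · eb), e ≈ X / eb, is absorbed by the ε-surplus m^(ea · b · X).
  absorb-loss : ∀ {c} a b ea eb .{{_ : NonZero eb}} X → 1 ≤ ea →
                m ^ ((a * eb + ea * b) * X) ≤ (c * m ^ (eb + X / eb)) ^ (b * eb) →
                m ^ (a * eb * X) ≤ c ^ (b * eb) * m ^ (b * eb * eb)
  absorb-loss {c} a b ea eb X ea≥1 hyp = ℕ.*-cancelʳ-≤ (m ^ (a * eb * X)) (c ^ (b * eb) * m ^ (b * eb * eb)) (m ^ (ea * b * X)) {{ℕ.m^n≢0 m (ea * b * X)}} (begin
    m ^ (a * eb * X) * m ^ (ea * b * X)              ≡⟨ ℕ.^-distribˡ-+-* m (a * eb * X) (ea * b * X) ⟨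
    m ^ (a * eb * X + ea * b * X)                    ≡⟨ cong (m ^_) (ℕ.*-distribʳ-+ X (a * eb) (ea * b)) ⟨
    m ^ ((a * eb + ea * b) * X)                      ≤⟨ hyp ⟩
    (c * m ^ e) ^ B                                  ≡⟨ ^-distrib-* c (m ^ e) B ⟩
    c ^ B * (m ^ e) ^ B                              ≡⟨ cong (c ^ B *_) (ℕ.^-*-assoc m e B) ⟩
    c ^ B * m ^ (e * B)                              ≤⟨ ℕ.*-monoʳ-≤ (c ^ B) (ℕ.^-monoʳ-≤ m loss≤) ⟩
    c ^ B * m ^ (B * eb + ea * b * X)                ≡⟨ cong (c ^ B *_) (ℕ.^-distribˡ-+-* m (B * eb) (ea * b * X)) ⟩
    c ^ B * (m ^ (B * eb) * m ^ (ea * b * X))        ≡⟨ ℕ.*-assoc (c ^ B) _ _ ⟨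
    c ^ B * m ^ (B * eb) * m ^ (ea * b * X)          ∎)
    where
    open ℕ.≤-Reasoning
    e = eb + X / eb
    B = b * eb
    expand : ∀ eb q b → (eb + q) * (b * eb) ≡ b * eb * eb + b * (q * eb)
    expand = ℕ-Solver.solve-∀
    reorder : ∀ b ea X → b * (ea * X) ≡ ea * b * X
    reorder = ℕ-Solver.solve-∀
    loss≤ : e * B ≤ B * eb + ea * b * X
    loss≤ = begin
      e * B                        ≡⟨ expand eb (X / eb) b ⟩
      B * eb + b * (X / eb * eb)   ≤⟨ ℕ.+-monoʳ-≤ (B * eb) (ℕ.*-monoʳ-≤ b (ℕ.≤-trans (m/n*n≤m X eb) (ℕ.m≤n*m X ea {{ℕ.>-nonZero ea≥1}}))) ⟩
      B * eb + b * (ea * X)        ≡⟨ cong (λ t → B * eb + t) (reorder b ea X) ⟩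
      B * eb + ea * b * X          ∎

  N^a≤ : ∀ {c N} a b eb .{{_ : NonZero eb}} X → a * eb ≤ b * eb → N < m ^ (2 + X) →
         m ^ (a * eb * X) ≤ c ^ (b * eb) * m ^ (b * eb * eb) → N ^ a ≤ (m ^ (eb + 2)) ^ b * c ^ b
  N^a≤ {c} {N} a b eb X a*eb≤b*eb N<m^[2+X] hyp = ^-cancelˡ-≤ eb (begin
    (N ^ a) ^ eb                                   ≡⟨ ℕ.^-*-assoc N a eb ⟩
    N ^ (a * eb)                                   ≤⟨ ℕ.^-monoˡ-≤ (a * eb) (ℕ.<⇒≤ N<m^[2+X]) ⟩
    (m ^ (2 + X)) ^ (a * eb)                       ≡⟨ ℕ.^-*-assoc m (2 + X) (a * eb) ⟩
    m ^ ((2 + X) * (a * eb))                       ≡⟨ cong (m ^_) (split X (a * eb)) ⟩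
    m ^ (2 * (a * eb) + a * eb * X)                ≡⟨ ℕ.^-distribˡ-+-* m (2 * (a * eb)) (a * eb * X) ⟩
    m ^ (2 * (a * eb)) * m ^ (a * eb * X)          ≤⟨ ℕ.*-mono-≤ (ℕ.^-monoʳ-≤ m (ℕ.*-monoʳ-≤ 2 a*eb≤b*eb)) hyp ⟩
    m ^ (2 * B) * (c ^ B * m ^ (B * eb))           ≡⟨ ℕ*.x∙yz≈y∙xz (m ^ (2 * B)) (c ^ B) _ ⟩
    c ^ B * (m ^ (2 * B) * m ^ (B * eb))           ≡⟨ cong (c ^ B *_) (ℕ.^-distribˡ-+-* m (2 * B) (B * eb)) ⟨
    c ^ B * m ^ (2 * B + B * eb)                   ≡⟨ cong (λ t → c ^ B * m ^ t) (gather b eb) ⟩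
    c ^ B * m ^ ((eb + 2) * b * eb)                ≡⟨ ℕ.*-comm (c ^ B) _ ⟩
    m ^ ((eb + 2) * b * eb) * c ^ B                ≡⟨ cong₂ _*_ (trans (ℕ.^-*-assoc (m ^ (eb + 2)) b eb) (trans (ℕ.^-*-assoc m (eb + 2) B) (cong (m ^_) (sym (ℕ.*-assoc (eb + 2) b eb))))) (ℕ.^-*-assoc c b eb) ⟨
    ((m ^ (eb + 2)) ^ b) ^ eb * (c ^ b) ^ eb       ≡⟨ ^-distrib-* _ _ eb ⟨
    ((m ^ (eb + 2)) ^ b * c ^ b) ^ eb              ∎)
    where
    open ℕ.≤-Reasoning
    B = b * eb
    split : ∀ X y → (2 + X) * y ≡ 2 * y + y * X
    split = ℕ-Solver.solve-∀
    gather : ∀ b eb → 2 * (b * eb) + b * eb * eb ≡ (eb + 2) * b * eb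
    gather = ℕ-Solver.solve-∀

module Construction (m : ℕ) .{{_ : NonZero m}} (1<m : 1 < m) (k-1 : ℕ) .{{_ : NonZero k-1}} (R : ℕ → Subset m) where
  open Digits m
  open Valuation k-1

  -- digit 0 is frozen, so a configuration cannot live at scale m^0
  digitSets : ℕ → Subset m
  digitSets zero = ⁅ 0 mod m ⁆
  digitSets (suc j) = R (v (suc j))

  digitSets-separated : Admissible m k R → ∀ j → PowerSeparated k (digitSets (suc j * k)) (digitSets (suc j))
  digitSets-separated adm j = subst (λ n → PowerSeparated k (R n) (R (v (suc j)))) (sym (v-*k j)) (adm (v (suc j)))

  -- i ∈ A N L stands for the integer i + 1 (see _∈[_]), so A N L is 1 + withDigitsIn digitSets L
  A : (N L : ℕ) → Subset N
  A N L = fromList N (withDigitsIn digitSets L)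

  A-configFree : SquareFree m → Admissible m k R → ∀ N L → ConfigFree k (A N L)
  A-configFree sqf adm N L x y y≢0 (i₀ , i₀∈A , refl) (i₁ , i₁∈A , x+y≡) (i₂ , i₂∈A , x+yᵏ≡) =
    no-pattern sqf k (λ d∈ d′∈ → trans (x∈⁅y⁆⇒x≡y _ d∈) (sym (x∈⁅y⁆⇒x≡y _ d′∈))) (digitSets-separated adm)
      (digits i₀∈A) (digits i₁∈A) (digits i₂∈A) 1<m y y≢0 (unshift y x+y≡) (unshift (y ℤ.^ k) x+yᵏ≡)
    where
    digits : ∀ {i} → i ∈ A N L → HasDigitsIn digitSets L (toℕ i)
    digits i∈A = ∈withDigitsIn⇒ digitSets L (∈fromList⁻ i∈A)
    unshift : ∀ {a b} w → + suc a ℤ.+ w ≡ + suc b → + b ≡ + a ℤ.+ w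
    unshift {a} {b} w eq = trans (sym (ℤ.pred-suc (+ b))) (trans (cong ℤ.pred (sym eq)) (pred-suc-+ (+ a) w))
      where
      pred-suc-+ : ∀ a w → ℤ.pred (ℤ.suc a ℤ.+ w) ≡ a ℤ.+ w
      pred-suc-+ a w = trans (cong ℤ.pred (ℤ.+-assoc (+ 1) a w)) (ℤ.pred-suc (a ℤ.+ w))

  ∏ᵥ≤∣A∣ : ∀ N L → m ^ L ≤ N → ∏ᵥ (∣_∣ ∘ R) (ℕ.pred L) ≤ ∣ A N L ∣
  ∏ᵥ≤∣A∣ N L mᴸ≤N = subst (_≤ ∣ A N L ∣) (trans (length-withDigitsIn digitSets L) (count L))
    (length≤∣fromList∣ _ (withDigitsIn-unique digitSets L)
      (λ X∈ → ℕ.<-≤-trans (proj₁ (∈withDigitsIn⇒ digitSets L X∈)) mᴸ≤N))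
    where
    count : ∀ L → product (applyUpTo (∣_∣ ∘ digitSets) L) ≡ ∏ᵥ (∣_∣ ∘ R) (ℕ.pred L)
    count zero = refl
    count (suc X) = trans (cong (_* ∏ᵥ (∣_∣ ∘ R) X) (∣⁅x⁆∣≡1 (0 mod m))) (ℕ.*-identityˡ _)

  ∣R∣>0 : (∀ n → Nonempty (R n)) → ∀ n → 1 ≤ ∣ R n ∣
  ∣R∣>0 R≢∅ n = let (i , i∈R) = R≢∅ n in ℕ.≤-<-trans z≤n (x∈p⇒∣p-x∣<∣p∣ i∈R)

  A-large : (∀ n → Nonempty (R n)) → ∀ ea eb .{{_ : NonZero eb}} → 1 ≤ ea → ∀ N L → m ^ L ≤ N → N < m ^ suc L →
            ∀ (a : ℤ) b → LtGamma m k R ((a ℤ.* + eb) ℤ.+ (+ ea ℤ.* + b)) (b * eb) →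
            BoundBelow 1 (m ^ (eb + 2)) a b N ∣ A N L ∣
  A-large R≢∅ ea eb ea≥1 N L mᴸ≤N _ -[1+ a ] b _ =
    BoundBelow-negative a b (ℕ.m^n>0 m (eb + 2))
      (ℕ.≤-trans (∏ᵥ-positive _ (∣R∣>0 R≢∅) (ℕ.pred L)) (∏ᵥ≤∣A∣ N L mᴸ≤N)) (ℕ.≤-trans (ℕ.m^n>0 m L) mᴸ≤N)
  A-large R≢∅ ea eb ea≥1 N L mᴸ≤N N<m^[1+L] (+ a) b a/b+ε<γ
    with subst (λ t → LtGamma m k R t (b * eb)) (sym (pos-*+* a eb ea b)) a/b+ε<γ
  ... | M , mᵃ′ᴷ<Pᵇ′⁽ᵏ⁻¹⁾ = begin
    1 ^ b * N ^ a                          ≡⟨ trans (cong (_* N ^ a) (ℕ.^-zeroˡ b)) (ℕ.*-identityˡ (N ^ a)) ⟩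
    N ^ a                                  ≤⟨ N^a≤ m a b eb X a*eb≤b*eb N<m^[2+X] (absorb-loss m a b ea eb X ea≥1 mᵃ′ˣ≤) ⟩
    (m ^ (eb + 2)) ^ b * c ^ b             ≤⟨ ℕ.*-monoʳ-≤ ((m ^ (eb + 2)) ^ b) (ℕ.^-monoˡ-≤ b (∏ᵥ≤∣A∣ N L mᴸ≤N)) ⟩
    (m ^ (eb + 2)) ^ b * ∣ A N L ∣ ^ b     ∎
    where
    open ℕ.≤-Reasoning
    X = ℕ.pred L
    e = eb + X / eb
    c = ∏ᵥ (∣_∣ ∘ R) X
    K = k ^ M
    T = P m k R M ^ k-1
    mᵃ′ᴷ<Tᵇ′ : m ^ ((a * eb + ea * b) * K) < T ^ (b * eb)
    mᵃ′ᴷ<Tᵇ′ = subst (m ^ ((a * eb + ea * b) * K) <_) (sym ([a^m]^n≡a^[n*m] (P m k R M) k-1 (b * eb))) mᵃ′ᴷ<Pᵇ′⁽ᵏ⁻¹⁾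
    a*eb≤b*eb : a * eb ≤ b * eb
    a*eb≤b*eb = ℕ.≤-trans (ℕ.m≤m+n (a * eb) (ea * b)) (ℕ.<⇒≤ (exponent-< m 1<m (P^[k-1]≤ R M) mᵃ′ᴷ<Tᵇ′))
    X<kᵉ : X < k ^ e
    X<kᵉ = ℕ.<-≤-trans (n<2^[d+n/d] eb X) (ℕ.^-monoˡ-≤ e 1<k)
    mᵃ′ˣ≤ : m ^ ((a * eb + ea * b) * X) ≤ (c * m ^ e) ^ (b * eb)
    mᵃ′ˣ≤ = ^-transfer m T (c * m ^ e) K {{ℕ.m^n≢0 k M}} (a * eb + ea * b) (b * eb) X (ℕ.<⇒≤ mᵃ′ᴷ<Tᵇ′) (P^[k-1]^X≤ R (∣R∣>0 R≢∅) M X e X<kᵉ)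
    N<m^[2+X] : N < m ^ (2 + X)
    N<m^[2+X] = ℕ.<-≤-trans N<m^[1+L] (ℕ.^-monoʳ-≤ m (s≤s (L≤1+pred L)))
      where
      L≤1+pred : ∀ L → L ≤ suc (ℕ.pred L)
      L≤1+pred zero = z≤n
      L≤1+pred (suc L) = ℕ.≤-refl

theorem1p5 : (m : ℕ) → m ≥ 2 → SquareFree m →
    (ea eb : ℕ) → ea ≥ 1 → eb ≥ 1 →
    Σ ℕ λ p → Σ ℕ λ q → p ≥ 1 × q ≥ 1 ×
      ((k : ℕ) → k ≥ 2 → (R : ℕ → Subset m) → (∀ n → Nonempty (R n)) →
       Admissible m k R →
       (N : ℕ) → N ≥ 1 →
       Σ (Subset N) λ A → ConfigFree k A ×
         ((a : ℤ) (b : ℕ) → b ≥ 1 →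
          LtGamma m k R ((a ℤ.* + eb) ℤ.+ (+ ea ℤ.* + b)) (b * eb) →
          BoundBelow p q a b N ∣ A ∣))
theorem1p5 m@(suc (suc _)) (s≤s (s≤s z≤n)) sqf ea eb@(suc _) ea≥1 (s≤s z≤n) =
  1 , m ^ (eb + 2) , ℕ.≤-refl , ℕ.m^n>0 m (eb + 2) , λ where
    (suc k-1@(suc _)) (s≤s (s≤s z≤n)) R R≢∅ adm N N≥1 →
      let open Construction m 1<m k-1 R
          (L , mᴸ≤N , N<m^[1+L]) = power-bracket m 1<m N N≥1
      in A N L , A-configFree sqf adm N L , λ a b _ → A-large R≢∅ ea eb ea≥1 N L mᴸ≤N N<m^[1+L] a b
  where
  1<m : 1 < m
  1<m = s≤s (s≤s z≤n)
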